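{- Let $k$ and $m$ be positive integers and $s$ a non-negative integer. Then $$\bigl((s+1)_m\bigr)^{k+1}\ {}_{k+2}F_{k+1}\!\left[\begin{matrix}-((k+1)m+1),\ -s,\ \dots,\ -s\\ -(m+s),\ \dots,\ -(m+s)\end{matrix}\right]=\bigl((km+1-s)_m\bigr)^{k+1}\ {}_{k+2}F_{k+1}\!\left[\begin{matrix}-((k+1)m+1),\ -(km-s),\ \dots,\ -(km-s)\\ -((k+1)m-s),\ \dots,\ -((k+1)m-s)\end{matrix}\right],$$ where on each side the upper parameter list consists of the first entry followed by $k+1$ equal entries and the lower list of $k+1$ equal entries.
   Context: For real $a$ and integer $n\ge0$, $(a)_n=a(a+1)\cdots(a+n-1)$ with $(a)_0=1$. The hypergeometric series is ${}_{m+1}F_m\!\left[\begin{smallmatrix}a_0,a_1,\dots,a_m\\ b_1,\dots,b_m\end{smallmatrix}\right]=\sum_{r\ge0}\frac{(a_0)_r(a_1)_r\cdots(a_m)_r}{r!\,(b_1)_r\cdots(b_m)_r}$. When a numerator parameter is a non-positive integer $-N$, $(-N)_r=0$ for $r>N$, so the series terminates and is understood as the resulting finite sum. -}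

module Defs where

open import Data.Nat using (ℕ; zero; suc; _!)
import Data.Integer as ℤ
open import Data.Rational using (ℚ; 0ℚ; 1ℚ; _+_; _*_; -_; _÷_; ≢-nonZero)
  renaming (_/_ to _/ℤ_)
open import Data.Rational.Properties using (_≟_)
open import Data.List using (List; []; _∷_; map; foldr; replicate)
open import Relation.Nullary using (yes; no)
import Data.Rational as ℚ

ℕ→ℚ : ℕ → ℚ
ℕ→ℚ n = ℤ.+ n /ℤ 1

poch : ℚ → ℕ → ℚ
poch a zero    = 1ℚ
poch a (suc n) = poch a n * (a + ℕ→ℚ n)

_^_ : ℚ → ℕ → ℚ
x ^ zero  = 1ℚ
x ^ suc n = x * (x ^ n)

prodℚ : List ℚ → ℚ
prodℚ = foldr _*_ 1ℚ

-- total division with the convention p /₀ 0 = 0 (only ever used on 0/0 terms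
-- of terminating series)
_/₀_ : ℚ → ℚ → ℚ
p /₀ q with q ≟ 0ℚ
... | yes _  = 0ℚ
... | no q≢0 = _÷_ p q {{≢-nonZero q≢0}}

hypTerm : ℕ → List ℚ → List ℚ → ℕ → ℚ
hypTerm N as bs r =
  (poch (- ℕ→ℚ N) r * prodℚ (map (λ a → poch a r) as))
    /₀ (ℕ→ℚ (r !) * prodℚ (map (λ b → poch b r) bs))

sumTo : ℕ → (ℕ → ℚ) → ℚ
sumTo zero    f = f 0
sumTo (suc n) f = sumTo n f + f (suc n)

-- Terminating series  _{p+1}F_p [ -N, a_1..a_p ; b_1..b_p ] = Σ_{r=0}^{N} term_r
hypF : ℕ → List ℚ → List ℚ → ℚ
hypF N as bs = sumTo N (hypTerm N as bs)

-- Write x for the upper parameter and K = k + 1, N = Km + 1, so that each side has the form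
--   F x = ((x+1)_m)^K · Σ_{r ≤ N} (-N)_r ((-x)_r)^K / (r! ((-(x+m))_r)^K)
-- at x = s resp. x = km - s.  Whenever (-(x+m))_r ≠ 0 the r-th summand equals
--   Φ x r = (-1)^r C(N, r) · ((x+1-r)_m)^K,
-- because (x+1)_m (-x)_r = (x+1-r)_m (-(x+m))_r.  As a function of r, ((x+1-r)_m)^K is a
-- polynomial of degree Km < N, so the alternating binomial sum Σ_{r ≤ N} Φ x r vanishes.
-- For a natural number s ≤ km the sum F s stops at r = s (beyond it the numerator contains
-- (-s)_r = 0, and _/₀_ turns the 0/0 terms into 0 as well), and the reflection r ↦ N - r,
-- under which Φ s (N - j) = -Φ (km - s) j, carries the rest of Σ_r Φ s r onto -F (km - s).
-- For s > km both F s and F (km - s) are either a complete sum Σ_r Φ x r or have a vanishing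
-- prefactor, hence both are 0.

module Submission where

open import Defs
open import Data.Nat using (ℕ; suc; _≤_) renaming (_+_ to _+ℕ_; _*_ to _*ℕ_)
open import Data.Rational using (ℚ; 1ℚ; _+_; _-_; _*_; -_)
open import Data.List using (replicate)
open import Relation.Binary.PropositionalEquality using (_≡_)

open import Data.Nat using (zero; _<_; _∸_; _!; z≤n; s≤s; _≤?_)
import Data.Nat.Properties as ℕ
open import Data.Nat.Tactic.RingSolver using (solve-∀)
import Data.Integer as ℤ
import Data.Integer.Properties as ℤ
open import Data.Rational using (0ℚ; 1/_; ↥_; ≢-nonZero)
open import Data.Rational.Properties
  using ( _≟_; normalize-coprime; /-cong
        ; +-assoc; +-comm; +-identityˡ; +-identityʳ; +-inverseˡ
        ; *-assoc; *-comm; *-identityˡ; *-identityʳ; *-zeroˡ; *-zeroʳ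
        ; *-inverseˡ; *-inverseʳ; *-distribˡ-+ )
open import Data.Rational.Solver using (module +-*-Solver)
open import Data.Nat.Coprimality using (1-coprimeTo) renaming (sym to coprime-sym)
open import Data.List using (map)
open import Data.Sum using (inj₁; inj₂)
open import Relation.Nullary using (¬_; yes; no)
open import Data.Empty using (⊥-elim)
open import Relation.Binary.PropositionalEquality
  using (refl; sym; trans; cong; cong₂; subst; module ≡-Reasoning)

open +-*-Solver
open ≡-Reasoning

-- The right-hand side unfolds to (+ 1 + (+ ◃ n * 1)) / (1 * 1).
ℕ→ℚ-suc : ∀ n → ℕ→ℚ (suc n) ≡ 1ℚ + ℕ→ℚ n
ℕ→ℚ-suc n =
  trans (/-cong (cong (ℤ._+_ (ℤ.+ 1)) (sym (trans (ℤ.+◃n≡+n (n *ℕ 1)) (cong ℤ.+_ (ℕ.*-identityʳ n))))) refl)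
        (cong (1ℚ +_) (sym (normalize-coprime (coprime-sym (1-coprimeTo n)))))

ℕ→ℚ-+ : ∀ a b → ℕ→ℚ (a +ℕ b) ≡ ℕ→ℚ a + ℕ→ℚ b
ℕ→ℚ-+ zero    b = sym (+-identityˡ (ℕ→ℚ b))
ℕ→ℚ-+ (suc a) b = begin
  ℕ→ℚ (suc (a +ℕ b))       ≡⟨ ℕ→ℚ-suc (a +ℕ b) ⟩
  1ℚ + ℕ→ℚ (a +ℕ b)        ≡⟨ cong (1ℚ +_) (ℕ→ℚ-+ a b) ⟩
  1ℚ + (ℕ→ℚ a + ℕ→ℚ b)     ≡⟨ sym (+-assoc 1ℚ (ℕ→ℚ a) (ℕ→ℚ b)) ⟩
  (1ℚ + ℕ→ℚ a) + ℕ→ℚ b     ≡⟨ cong (_+ ℕ→ℚ b) (sym (ℕ→ℚ-suc a)) ⟩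
  ℕ→ℚ (suc a) + ℕ→ℚ b      ∎

ℕ→ℚ-* : ∀ a b → ℕ→ℚ (a *ℕ b) ≡ ℕ→ℚ a * ℕ→ℚ b
ℕ→ℚ-* zero    b = sym (*-zeroˡ (ℕ→ℚ b))
ℕ→ℚ-* (suc a) b = begin
  ℕ→ℚ (b +ℕ a *ℕ b)          ≡⟨ ℕ→ℚ-+ b (a *ℕ b) ⟩
  ℕ→ℚ b + ℕ→ℚ (a *ℕ b)       ≡⟨ cong (ℕ→ℚ b +_) (ℕ→ℚ-* a b) ⟩
  ℕ→ℚ b + ℕ→ℚ a * ℕ→ℚ b      ≡⟨ solve 2 (λ a b → b :+ a :* b := (con 1ℚ :+ a) :* b) refl (ℕ→ℚ a) (ℕ→ℚ b) ⟩
  (1ℚ + ℕ→ℚ a) * ℕ→ℚ b       ≡⟨ cong (_* ℕ→ℚ b) (sym (ℕ→ℚ-suc a)) ⟩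
  ℕ→ℚ (suc a) * ℕ→ℚ b        ∎

ℕ→ℚ-∸ : ∀ a b → b ≤ a → ℕ→ℚ (a ∸ b) ≡ ℕ→ℚ a - ℕ→ℚ b
ℕ→ℚ-∸ a b b≤a = begin
  ℕ→ℚ (a ∸ b)                      ≡⟨ solve 2 (λ x y → x := (x :+ y) :- y) refl (ℕ→ℚ (a ∸ b)) (ℕ→ℚ b) ⟩
  (ℕ→ℚ (a ∸ b) + ℕ→ℚ b) - ℕ→ℚ b    ≡⟨ cong (_- ℕ→ℚ b) (sym (ℕ→ℚ-+ (a ∸ b) b)) ⟩
  ℕ→ℚ (a ∸ b +ℕ b) - ℕ→ℚ b         ≡⟨ cong (λ z → ℕ→ℚ z - ℕ→ℚ b) (ℕ.m∸n+n≡m b≤a) ⟩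
  ℕ→ℚ a - ℕ→ℚ b                    ∎

ℕ→ℚ-injective : ∀ {a b} → ℕ→ℚ a ≡ ℕ→ℚ b → a ≡ b
ℕ→ℚ-injective {a} {b} e = ℤ.+-injective (cong ↥_
  (trans (sym (normalize-coprime (coprime-sym (1-coprimeTo a))))
         (trans e (normalize-coprime (coprime-sym (1-coprimeTo b))))))

ℕ→ℚ-suc≢0 : ∀ n → ¬ ℕ→ℚ (suc n) ≡ 0ℚ
ℕ→ℚ-suc≢0 n e with ℕ→ℚ-injective {suc n} {0} e
... | ()

ℕ→ℚ-!≢0 : ∀ r → ¬ ℕ→ℚ (r !) ≡ 0ℚ
ℕ→ℚ-!≢0 r e with r ! | ℕ.1≤n! r | e
... | suc q | _ | e′ = ℕ→ℚ-suc≢0 q e′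

*-≢0 : ∀ {p q} → ¬ p ≡ 0ℚ → ¬ q ≡ 0ℚ → ¬ p * q ≡ 0ℚ
*-≢0 {p} {q} p≢0 q≢0 pq≡0 = q≢0 (begin
  q                ≡⟨ sym (*-identityˡ q) ⟩
  1ℚ * q           ≡⟨ cong (_* q) (sym (*-inverseˡ p)) ⟩
  (1/ p * p) * q   ≡⟨ *-assoc (1/ p) p q ⟩
  1/ p * (p * q)   ≡⟨ cong (1/ p *_) pq≡0 ⟩
  1/ p * 0ℚ        ≡⟨ *-zeroʳ (1/ p) ⟩
  0ℚ               ∎)
  where instance _ = ≢-nonZero p≢0

*-cancelʳ-≢0 : ∀ {p q r} → ¬ r ≡ 0ℚ → p * r ≡ q * r → p ≡ q
*-cancelʳ-≢0 {p} {q} {r} r≢0 e = begin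
  p                ≡⟨ sym (*-identityʳ p) ⟩
  p * 1ℚ           ≡⟨ cong (p *_) (sym (*-inverseʳ r)) ⟩
  p * (r * 1/ r)   ≡⟨ sym (*-assoc p r (1/ r)) ⟩
  (p * r) * 1/ r   ≡⟨ cong (_* 1/ r) e ⟩
  (q * r) * 1/ r   ≡⟨ *-assoc q r (1/ r) ⟩
  q * (r * 1/ r)   ≡⟨ cong (q *_) (*-inverseʳ r) ⟩
  q * 1ℚ           ≡⟨ *-identityʳ q ⟩
  q                ∎
  where instance _ = ≢-nonZero r≢0

/₀-zeroˡ : ∀ q → 0ℚ /₀ q ≡ 0ℚ
/₀-zeroˡ q with q ≟ 0ℚ
... | yes _ = refl
... | no  q≢0 = *-zeroˡ ((1/ q) {{≢-nonZero q≢0}})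

/₀-*-inverse : ∀ p q → ¬ q ≡ 0ℚ → (p /₀ q) * q ≡ p
/₀-*-inverse p q q≢0 with q ≟ 0ℚ
... | yes q≡0 = ⊥-elim (q≢0 q≡0)
... | no  q≢0′ = begin
  (p * 1/ q) * q   ≡⟨ *-assoc p (1/ q) q ⟩
  p * (1/ q * q)   ≡⟨ cong (p *_) (*-inverseˡ q) ⟩
  p * 1ℚ           ≡⟨ *-identityʳ p ⟩
  p                ∎
  where instance _ = ≢-nonZero q≢0′

*-/₀-unique : ∀ {a b p q} → ¬ q ≡ 0ℚ → a * p ≡ b * q → a * (p /₀ q) ≡ b
*-/₀-unique {a} {b} {p} {q} q≢0 e = *-cancelʳ-≢0 q≢0 (begin
  a * (p /₀ q) * q     ≡⟨ *-assoc a (p /₀ q) q ⟩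
  a * ((p /₀ q) * q)   ≡⟨ cong (a *_) (/₀-*-inverse p q q≢0) ⟩
  a * p                ≡⟨ e ⟩
  b * q                ∎)

^-zero : ∀ {a} k → a ≡ 0ℚ → a ^ suc k ≡ 0ℚ
^-zero k refl = *-zeroˡ (0ℚ ^ k)

^-≢0 : ∀ {a} K → ¬ a ≡ 0ℚ → ¬ a ^ K ≡ 0ℚ
^-≢0 zero    _   ()
^-≢0 (suc K) a≢0 = *-≢0 a≢0 (^-≢0 K a≢0)

^-distribʳ-* : ∀ a b K → (a * b) ^ K ≡ a ^ K * b ^ K
^-distribʳ-* a b zero    = refl
^-distribʳ-* a b (suc K) = trans (cong ((a * b) *_) (^-distribʳ-* a b K))
  (solve 4 (λ a b x y → (a :* b) :* (x :* y) := (a :* x) :* (b :* y)) refl a b (a ^ K) (b ^ K))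

^-distribˡ-+-* : ∀ a m n → a ^ (m +ℕ n) ≡ a ^ m * a ^ n
^-distribˡ-+-* a zero    n = sym (*-identityˡ (a ^ n))
^-distribˡ-+-* a (suc m) n =
  trans (cong (a *_) (^-distribˡ-+-* a m n)) (sym (*-assoc a (a ^ m) (a ^ n)))

^-*-assoc : ∀ a m n → (a ^ m) ^ n ≡ a ^ (n *ℕ m)
^-*-assoc a m zero    = refl
^-*-assoc a m (suc n) =
  trans (cong (a ^ m *_) (^-*-assoc a m n)) (sym (^-distribˡ-+-* a m (n *ℕ m)))

^-zeroˡ : ∀ n → 1ℚ ^ n ≡ 1ℚ
^-zeroˡ zero    = refl
^-zeroˡ (suc n) = trans (*-identityˡ (1ℚ ^ n)) (^-zeroˡ n)

[-1]^n*[-1]^n≡1 : ∀ n → (- 1ℚ) ^ n * (- 1ℚ) ^ n ≡ 1ℚ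
[-1]^n*[-1]^n≡1 n = trans (sym (^-distribʳ-* (- 1ℚ) (- 1ℚ) n)) (^-zeroˡ n)

prodℚ-map-replicate : ∀ (g : ℚ → ℚ) a K → prodℚ (map g (replicate K a)) ≡ g a ^ K
prodℚ-map-replicate g a zero    = refl
prodℚ-map-replicate g a (suc K) = cong (g a *_) (prodℚ-map-replicate g a K)

sumTo-cong : ∀ n {f g : ℕ → ℚ} → (∀ r → r ≤ n → f r ≡ g r) → sumTo n f ≡ sumTo n g
sumTo-cong zero    f≗g = f≗g 0 z≤n
sumTo-cong (suc n) f≗g =
  cong₂ _+_ (sumTo-cong n (λ r r≤n → f≗g r (ℕ.m≤n⇒m≤1+n r≤n))) (f≗g (suc n) ℕ.≤-refl)

sumTo-+ : ∀ n f g → sumTo n (λ r → f r + g r) ≡ sumTo n f + sumTo n g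
sumTo-+ zero    f g = refl
sumTo-+ (suc n) f g = trans (cong (_+ (f (suc n) + g (suc n))) (sumTo-+ n f g))
  (solve 4 (λ a b c d → (a :+ b) :+ (c :+ d) := (a :+ c) :+ (b :+ d)) refl
     (sumTo n f) (sumTo n g) (f (suc n)) (g (suc n)))

sumTo-neg : ∀ n f → sumTo n (λ r → - f r) ≡ - sumTo n f
sumTo-neg zero    f = refl
sumTo-neg (suc n) f = trans (cong (_+ - f (suc n)) (sumTo-neg n f))
  (solve 2 (λ a b → (:- a) :+ (:- b) := :- (a :+ b)) refl (sumTo n f) (f (suc n)))

sumTo-- : ∀ n f g → sumTo n (λ r → f r - g r) ≡ sumTo n f - sumTo n g
sumTo-- n f g = trans (sumTo-+ n f (λ r → - g r)) (cong (sumTo n f +_) (sumTo-neg n g))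

sumTo-*ˡ : ∀ n a f → sumTo n (λ r → a * f r) ≡ a * sumTo n f
sumTo-*ˡ zero    a f = refl
sumTo-*ˡ (suc n) a f =
  trans (cong (_+ a * f (suc n)) (sumTo-*ˡ n a f)) (sym (*-distribˡ-+ a (sumTo n f) (f (suc n))))

sumTo-suc : ∀ n f → sumTo (suc n) f ≡ f 0 + sumTo n (λ r → f (suc r))
sumTo-suc zero    f = refl
sumTo-suc (suc n) f = trans (cong (_+ f (suc (suc n))) (sumTo-suc n f))
  (+-assoc (f 0) (sumTo n (λ r → f (suc r))) (f (suc (suc n))))

sumTo-split : ∀ a b f → sumTo (b +ℕ suc a) f ≡ sumTo a f + sumTo b (λ i → f (i +ℕ suc a))
sumTo-split a zero    f = refl
sumTo-split a (suc b) f = trans (cong (_+ f (suc b +ℕ suc a)) (sumTo-split a b f))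
  (+-assoc (sumTo a f) (sumTo b (λ i → f (i +ℕ suc a))) (f (suc b +ℕ suc a)))

sumTo-trailing-zeros : ∀ a b f → (∀ i → i < b → f (suc a +ℕ i) ≡ 0ℚ) → sumTo (a +ℕ b) f ≡ sumTo a f
sumTo-trailing-zeros a zero    f _ = cong (λ n → sumTo n f) (ℕ.+-identityʳ a)
sumTo-trailing-zeros a (suc b) f z = begin
  sumTo (a +ℕ suc b) f                ≡⟨ cong (λ n → sumTo n f) (ℕ.+-suc a b) ⟩
  sumTo (a +ℕ b) f + f (suc a +ℕ b)   ≡⟨ cong₂ _+_ (sumTo-trailing-zeros a b f (λ i i<b → z i (ℕ.m<n⇒m<1+n i<b)))
                                                   (z b ℕ.≤-refl) ⟩
  sumTo a f + 0ℚ                      ≡⟨ +-identityʳ (sumTo a f) ⟩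
  sumTo a f                           ∎

sumTo-reflect : ∀ n f g → (∀ i j → i +ℕ j ≡ n → f i ≡ g j) → sumTo n f ≡ sumTo n g
sumTo-reflect zero    f g f≗g = f≗g 0 0 refl
sumTo-reflect (suc n) f g f≗g = begin
  sumTo n f + f (suc n)                    ≡⟨ cong₂ _+_ (sumTo-reflect n f (λ j → g (suc j)) f≗g′)
                                                        (f≗g (suc n) 0 (ℕ.+-identityʳ (suc n))) ⟩
  sumTo n (λ j → g (suc j)) + g 0          ≡⟨ +-comm (sumTo n (λ j → g (suc j))) (g 0) ⟩
  g 0 + sumTo n (λ j → g (suc j))          ≡⟨ sym (sumTo-suc n g) ⟩
  sumTo (suc n) g                          ∎
  where
  f≗g′ : ∀ i j → i +ℕ j ≡ n → f i ≡ g (suc j)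
  f≗g′ i j e = f≗g i (suc j) (trans (ℕ.+-suc i j) (cong suc e))

-- altBinom n r = (-1)^r · C(n, r)
altBinom : ℕ → ℕ → ℚ
altBinom n       zero    = 1ℚ
altBinom zero    (suc r) = 0ℚ
altBinom (suc n) (suc r) = altBinom n (suc r) - altBinom n r

altBinom-vanish : ∀ n r → n < r → altBinom n r ≡ 0ℚ
altBinom-vanish zero    (suc r) _         = refl
altBinom-vanish (suc n) (suc r) (s≤s n<r) =
  cong₂ _-_ (altBinom-vanish n (suc r) (ℕ.m<n⇒m<1+n n<r)) (altBinom-vanish n r n<r)

altBinom-diag : ∀ n → altBinom n n ≡ (- 1ℚ) ^ n
altBinom-diag zero    = refl
altBinom-diag (suc n) =
  trans (cong₂ _-_ (altBinom-vanish n (suc n) ℕ.≤-refl) (altBinom-diag n))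
        (solve 1 (λ x → con 0ℚ :- x := (:- con 1ℚ) :* x) refl ((- 1ℚ) ^ n))

altBinom-reflect : ∀ i j n → i +ℕ j ≡ n → altBinom n i ≡ (- 1ℚ) ^ n * altBinom n j
altBinom-reflect zero j .j refl =
  trans (sym ([-1]^n*[-1]^n≡1 j)) (cong ((- 1ℚ) ^ j *_) (sym (altBinom-diag j)))
altBinom-reflect (suc i) zero ._ refl rewrite ℕ.+-identityʳ i =
  trans (altBinom-diag (suc i)) (sym (*-identityʳ ((- 1ℚ) ^ suc i)))
altBinom-reflect (suc i) (suc j) zero    ()
altBinom-reflect (suc i) (suc j) (suc n) e = begin
  altBinom n (suc i) - altBinom n i
    ≡⟨ cong₂ _-_ (altBinom-reflect (suc i) j n (trans (sym (ℕ.+-suc i j)) i+1+j≡n))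
                 (altBinom-reflect i (suc j) n i+1+j≡n) ⟩
  σ * altBinom n j - σ * altBinom n (suc j)
    ≡⟨ solve 3 (λ σ a b → σ :* a :- σ :* b := ((:- con 1ℚ) :* σ) :* (b :- a))
               refl σ (altBinom n j) (altBinom n (suc j)) ⟩
  (- 1ℚ * σ) * (altBinom n (suc j) - altBinom n j)
    ∎
  where
  σ : ℚ
  σ = (- 1ℚ) ^ n
  i+1+j≡n : i +ℕ suc j ≡ n
  i+1+j≡n = ℕ.suc-injective e

poch-sucˡ : ∀ y m → poch y (suc m) ≡ y * poch (y + 1ℚ) m
poch-sucˡ y zero    = solve 1 (λ y → con 1ℚ :* (y :+ con 0ℚ) := y :* con 1ℚ) refl y
poch-sucˡ y (suc m) = begin
  poch y (suc m) * (y + ℕ→ℚ (suc m))    ≡⟨ cong₂ _*_ (poch-sucˡ y m) (cong (y +_) (ℕ→ℚ-suc m)) ⟩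
  y * Q * (y + (1ℚ + M))                ≡⟨ solve 3 (λ y Q M → y :* Q :* (y :+ (con 1ℚ :+ M))
                                                         := y :* (Q :* ((y :+ con 1ℚ) :+ M))) refl y Q M ⟩
  y * (Q * ((y + 1ℚ) + M))              ∎
  where
  M : ℚ
  M = ℕ→ℚ m
  Q : ℚ
  Q = poch (y + 1ℚ) m

poch-Pascal : ∀ y r → poch (y - 1ℚ) (suc r) ≡ poch y (suc r) - ℕ→ℚ (suc r) * poch y r
poch-Pascal y r = begin
  poch (y - 1ℚ) (suc r)                 ≡⟨ poch-sucˡ (y - 1ℚ) r ⟩
  (y - 1ℚ) * poch (y - 1ℚ + 1ℚ) r       ≡⟨ cong (λ z → (y - 1ℚ) * poch z r)
                                               (solve 1 (λ y → y :- con 1ℚ :+ con 1ℚ := y) refl y) ⟩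
  (y - 1ℚ) * P                          ≡⟨ solve 3 (λ y R P → (y :- con 1ℚ) :* P
                                                         := P :* (y :+ R) :- (con 1ℚ :+ R) :* P) refl y R P ⟩
  P * (y + R) - (1ℚ + R) * P            ≡⟨ cong (λ z → P * (y + R) - z * P) (sym (ℕ→ℚ-suc r)) ⟩
  P * (y + R) - ℕ→ℚ (suc r) * P         ∎
  where
  R : ℚ
  R = ℕ→ℚ r
  P : ℚ
  P = poch y r

poch-neg-ℕ-vanish : ∀ i n → i < n → poch (- ℕ→ℚ i) n ≡ 0ℚ
poch-neg-ℕ-vanish i (suc n) i<1+n with ℕ.m≤n⇒m<n∨m≡n (ℕ.≤-pred i<1+n)
... | inj₁ i<n  = trans (cong (_* (- ℕ→ℚ i + ℕ→ℚ n)) (poch-neg-ℕ-vanish i n i<n))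
                        (*-zeroˡ (- ℕ→ℚ i + ℕ→ℚ n))
... | inj₂ refl = trans (cong (poch (- ℕ→ℚ i) i *_) (+-inverseˡ (ℕ→ℚ i)))
                        (*-zeroʳ (poch (- ℕ→ℚ i) i))

poch-neg-ℕ : ∀ N r → poch (- ℕ→ℚ N) r ≡ altBinom N r * ℕ→ℚ (r !)
poch-neg-ℕ N       zero    = refl
poch-neg-ℕ zero    (suc r) =
  trans (poch-neg-ℕ-vanish 0 (suc r) (s≤s z≤n)) (sym (*-zeroˡ (ℕ→ℚ (suc r !))))
poch-neg-ℕ (suc N) (suc r) = begin
  poch (- ℕ→ℚ (suc N)) (suc r)
    ≡⟨ cong (λ z → poch z (suc r)) (trans (cong -_ (ℕ→ℚ-suc N))
                                          (solve 1 (λ n → :- (con 1ℚ :+ n) := :- n :- con 1ℚ) refl (ℕ→ℚ N))) ⟩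
  poch (- ℕ→ℚ N - 1ℚ) (suc r)
    ≡⟨ poch-Pascal (- ℕ→ℚ N) r ⟩
  poch (- ℕ→ℚ N) (suc r) - R * poch (- ℕ→ℚ N) r
    ≡⟨ cong₂ (λ u v → u - R * v) (poch-neg-ℕ N (suc r)) (poch-neg-ℕ N r) ⟩
  altBinom N (suc r) * ℕ→ℚ (suc r !) - R * (altBinom N r * F)
    ≡⟨ cong (λ z → altBinom N (suc r) * z - R * (altBinom N r * F)) (ℕ→ℚ-* (suc r) (r !)) ⟩
  altBinom N (suc r) * (R * F) - R * (altBinom N r * F)
    ≡⟨ solve 4 (λ a b R F → a :* (R :* F) :- R :* (b :* F) := (a :- b) :* (R :* F))
               refl (altBinom N (suc r)) (altBinom N r) R F ⟩
  (altBinom N (suc r) - altBinom N r) * (R * F)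
    ≡⟨ cong ((altBinom N (suc r) - altBinom N r) *_) (sym (ℕ→ℚ-* (suc r) (r !))) ⟩
  altBinom (suc N) (suc r) * ℕ→ℚ (suc r !)
    ∎
  where
  R : ℚ
  R = ℕ→ℚ (suc r)
  F : ℚ
  F = ℕ→ℚ (r !)

poch-neg-ℕ-≢0 : ∀ N r → r ≤ N → ¬ poch (- ℕ→ℚ N) r ≡ 0ℚ
poch-neg-ℕ-≢0 N zero    _   ()
poch-neg-ℕ-≢0 N (suc r) r<N = *-≢0 (poch-neg-ℕ-≢0 N r (ℕ.<⇒≤ r<N)) factor≢0
  where
  factor≢0 : ¬ - ℕ→ℚ N + ℕ→ℚ r ≡ 0ℚ
  factor≢0 e = ℕ.<-irrefl (ℕ→ℚ-injective (begin
    ℕ→ℚ r                        ≡⟨ solve 2 (λ n r → r := (:- n :+ r) :+ n) refl (ℕ→ℚ N) (ℕ→ℚ r) ⟩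
    (- ℕ→ℚ N + ℕ→ℚ r) + ℕ→ℚ N    ≡⟨ cong (_+ ℕ→ℚ N) e ⟩
    0ℚ + ℕ→ℚ N                   ≡⟨ +-identityˡ (ℕ→ℚ N) ⟩
    ℕ→ℚ N                        ∎)) r<N

poch-ℕ-suc-≢0 : ∀ v r → ¬ poch (ℕ→ℚ (suc v)) r ≡ 0ℚ
poch-ℕ-suc-≢0 v zero    ()
poch-ℕ-suc-≢0 v (suc r) =
  *-≢0 (poch-ℕ-suc-≢0 v r) (λ e → ℕ→ℚ-suc≢0 (v +ℕ r) (trans (ℕ→ℚ-+ (suc v) r) e))

poch-exchange : ∀ x m r →
  poch (x + 1ℚ) m * poch (- x) r ≡ poch ((x + 1ℚ) - ℕ→ℚ r) m * poch (- (x + ℕ→ℚ m)) r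
poch-exchange x m zero    =
  cong (λ z → poch z m * 1ℚ) (solve 1 (λ x → x :+ con 1ℚ := (x :+ con 1ℚ) :- con 0ℚ) refl x)
poch-exchange x m (suc r) = begin
  P * (poch (- x) r * (- x + R))
    ≡⟨ sym (*-assoc P (poch (- x) r) (- x + R)) ⟩
  P * poch (- x) r * (- x + R)
    ≡⟨ cong (_* (- x + R)) (poch-exchange x m r) ⟩
  poch ((x + 1ℚ) - R) m * D * (- x + R)
    ≡⟨ cong (λ z → poch z m * D * (- x + R)) (solve 2 (λ x R → (x :+ con 1ℚ) :- R := (x :- R) :+ con 1ℚ) refl x R) ⟩
  poch (y + 1ℚ) m * D * (- x + R)
    ≡⟨ solve 4 (λ x R Q D → Q :* D :* (:- x :+ R) := :- ((x :- R) :* Q) :* D) refl x R (poch (y + 1ℚ) m) D ⟩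
  - (y * poch (y + 1ℚ) m) * D
    ≡⟨ cong (λ z → - z * D) (sym (poch-sucˡ y m)) ⟩
  - (poch y m * (y + M)) * D
    ≡⟨ solve 5 (λ x R Q M D → :- (Q :* ((x :- R) :+ M)) :* D := Q :* (D :* (:- (x :+ M) :+ R)))
               refl x R (poch y m) M D ⟩
  poch y m * (D * (- (x + M) + R))
    ≡⟨ cong (λ z → poch z m * (D * (- (x + M) + R))) y≡ ⟩
  poch ((x + 1ℚ) - ℕ→ℚ (suc r)) m * (D * (- (x + M) + R))
    ∎
  where
  R : ℚ
  R = ℕ→ℚ r
  M : ℚ
  M = ℕ→ℚ m
  P : ℚ
  P = poch (x + 1ℚ) m
  D : ℚ
  D = poch (- (x + M)) r
  y : ℚ
  y = x - R
  y≡ : x - R ≡ (x + 1ℚ) - ℕ→ℚ (suc r)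
  y≡ = trans (solve 2 (λ x R → x :- R := (x :+ con 1ℚ) :- (con 1ℚ :+ R)) refl x R)
             (cong (λ z → (x + 1ℚ) - z) (sym (ℕ→ℚ-suc r)))

poch-reflect : ∀ y m → poch (- (y + ℕ→ℚ m) + 1ℚ) m ≡ (- 1ℚ) ^ m * poch y m
poch-reflect y zero    = refl
poch-reflect y (suc m) = begin
  poch A m * (A + M)
    ≡⟨ cong₂ (λ u v → poch u m * v) A≡ A+M≡ ⟩
  poch (- ((y + 1ℚ) + M) + 1ℚ) m * (- y)
    ≡⟨ cong (_* (- y)) (poch-reflect (y + 1ℚ) m) ⟩
  σ * poch (y + 1ℚ) m * (- y)
    ≡⟨ solve 3 (λ σ Q y → σ :* Q :* (:- y) := (:- con 1ℚ :* σ) :* (y :* Q)) refl σ (poch (y + 1ℚ) m) y ⟩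
  (- 1ℚ * σ) * (y * poch (y + 1ℚ) m)
    ≡⟨ cong (- 1ℚ * σ *_) (sym (poch-sucˡ y m)) ⟩
  (- 1ℚ * σ) * poch y (suc m)
    ∎
  where
  M : ℚ
  M = ℕ→ℚ m
  σ : ℚ
  σ = (- 1ℚ) ^ m
  A : ℚ
  A = - (y + ℕ→ℚ (suc m)) + 1ℚ
  A≡′ : A ≡ - (y + (1ℚ + M)) + 1ℚ
  A≡′ = cong (λ z → - (y + z) + 1ℚ) (ℕ→ℚ-suc m)
  A≡ : A ≡ - ((y + 1ℚ) + M) + 1ℚ
  A≡ = trans A≡′ (solve 2 (λ y M → :- (y :+ (con 1ℚ :+ M)) :+ con 1ℚ := :- ((y :+ con 1ℚ) :+ M) :+ con 1ℚ) refl y M)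
  A+M≡ : A + M ≡ - y
  A+M≡ = trans (cong (_+ M) A≡′) (solve 2 (λ y M → :- (y :+ (con 1ℚ :+ M)) :+ con 1ℚ :+ M := :- y) refl y M)

-- Finite differences

Δ : (ℕ → ℚ) → ℕ → ℚ
Δ f r = f (suc r) - f r

Degree< : ℕ → (ℕ → ℚ) → Set
Degree< zero    f = ∀ r → f r ≡ 0ℚ
Degree< (suc n) f = Degree< n (Δ f)

Degree<-cong : ∀ n {f g : ℕ → ℚ} → (∀ r → f r ≡ g r) → Degree< n f → Degree< n g
Degree<-cong zero    f≗g df r = trans (sym (f≗g r)) (df r)
Degree<-cong (suc n) f≗g df = Degree<-cong n (λ r → cong₂ _-_ (f≗g (suc r)) (f≗g r)) df

Degree<-+ : ∀ n f g → Degree< n f → Degree< n g → Degree< n (λ r → f r + g r)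
Degree<-+ zero    f g df dg r = trans (cong₂ _+_ (df r) (dg r)) (+-identityʳ 0ℚ)
Degree<-+ (suc n) f g df dg = Degree<-cong n
  (λ r → solve 4 (λ a b c d → (a :- b) :+ (c :- d) := (a :+ c) :- (b :+ d)) refl
           (f (suc r)) (f r) (g (suc r)) (g r))
  (Degree<-+ n (Δ f) (Δ g) df dg)

Degree<-*ˡ : ∀ n a f → Degree< n f → Degree< n (λ r → a * f r)
Degree<-*ˡ zero    a f df r = trans (cong (a *_) (df r)) (*-zeroʳ a)
Degree<-*ˡ (suc n) a f df = Degree<-cong n
  (λ r → solve 3 (λ a x y → a :* (x :- y) := a :* x :- a :* y) refl a (f (suc r)) (f r))
  (Degree<-*ˡ n a (Δ f) df)

Degree<-shift : ∀ n f → Degree< n f → Degree< n (λ r → f (suc r))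
Degree<-shift zero    f df r = df (suc r)
Degree<-shift (suc n) f df = Degree<-shift n (Δ f) df

Degree<1⇒constant : ∀ f → Degree< 1 f → ∀ r → f r ≡ f 0
Degree<1⇒constant f df zero    = refl
Degree<1⇒constant f df (suc r) = begin
  f (suc r)                   ≡⟨ solve 2 (λ x y → x := (x :- y) :+ y) refl (f (suc r)) (f r) ⟩
  (f (suc r) - f r) + f r     ≡⟨ cong (_+ f r) (df r) ⟩
  0ℚ + f r                    ≡⟨ +-identityˡ (f r) ⟩
  f r                         ≡⟨ Degree<1⇒constant f df r ⟩
  f 0                         ∎

Δ-* : ∀ f g r → Δ (λ r → f r * g r) r ≡ f (suc r) * Δ g r + Δ f r * g r
Δ-* f g r = solve 4 (λ f₁ f₀ g₁ g₀ → f₁ :* g₁ :- f₀ :* g₀ := f₁ :* (g₁ :- g₀) :+ (f₁ :- f₀) :* g₀)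
                    refl (f (suc r)) (f r) (g (suc r)) (g r)

Degree<-* : ∀ d e f g → Degree< (suc d) f → Degree< (suc e) g → Degree< (suc (d +ℕ e)) (λ r → f r * g r)
Degree<-* zero    e f g df dg = Degree<-cong (suc e)
  (λ r → cong (_* g r) (sym (Degree<1⇒constant f df r))) (Degree<-*ˡ (suc e) (f 0) g dg)
Degree<-* (suc d) zero    f g df dg rewrite ℕ.+-identityʳ d = Degree<-cong (suc (suc d))
  (λ r → trans (*-comm (g 0) (f r)) (cong (f r *_) (sym (Degree<1⇒constant g dg r))))
  (Degree<-*ˡ (suc (suc d)) (g 0) f df)
Degree<-* (suc d) (suc e) f g df dg = Degree<-cong (suc (d +ℕ suc e)) (λ r → sym (Δ-* f g r))
  (Degree<-+ (suc (d +ℕ suc e)) (λ r → f (suc r) * Δ g r) (λ r → Δ f r * g r) shifted differenced)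
  where
  shifted : Degree< (suc (d +ℕ suc e)) (λ r → f (suc r) * Δ g r)
  shifted = subst (λ n → Degree< n (λ r → f (suc r) * Δ g r)) (cong suc (sym (ℕ.+-suc d e)))
                  (Degree<-* (suc d) e (λ r → f (suc r)) (Δ g) (Degree<-shift (suc (suc d)) f df) dg)
  differenced : Degree< (suc (d +ℕ suc e)) (λ r → Δ f r * g r)
  differenced = Degree<-* d (suc e) (Δ f) g df dg

Degree<-^ : ∀ d f K → Degree< (suc d) f → Degree< (suc (K *ℕ d)) (λ r → f r ^ K)
Degree<-^ d f zero    df r = refl
Degree<-^ d f (suc K) df = Degree<-* d (K *ℕ d) f (λ r → f r ^ K) df (Degree<-^ d f K df)

Degree<-linear : ∀ b → Degree< 2 (λ r → b - ℕ→ℚ r)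
Degree<-linear b = Degree<-cong 1 (λ r → sym (Δ≡-1 r)) (λ r → refl)
  where
  Δ≡-1 : ∀ r → (b - ℕ→ℚ (suc r)) - (b - ℕ→ℚ r) ≡ - 1ℚ
  Δ≡-1 r = trans (cong (λ z → (b - z) - (b - ℕ→ℚ r)) (ℕ→ℚ-suc r))
                 (solve 2 (λ b x → (b :- (con 1ℚ :+ x)) :- (b :- x) := :- con 1ℚ) refl b (ℕ→ℚ r))

Degree<-poch : ∀ b m → Degree< (suc m) (λ r → poch (b - ℕ→ℚ r) m)
Degree<-poch b zero    r = refl
Degree<-poch b (suc m) = subst (λ n → Degree< (suc n) (λ r → poch (b - ℕ→ℚ r) (suc m))) (ℕ.+-comm m 1)
  (Degree<-* m 1 (λ r → poch (b - ℕ→ℚ r) m) (λ r → b - ℕ→ℚ r + ℕ→ℚ m) (Degree<-poch b m)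
    (Degree<-cong 2 (λ r → solve 3 (λ b M x → (b :+ M) :- x := b :- x :+ M) refl b (ℕ→ℚ m) (ℕ→ℚ r))
      (Degree<-linear (b + ℕ→ℚ m))))

alternating-sum-suc : ∀ n f →
  sumTo (suc n) (λ r → altBinom (suc n) r * f r) ≡ - sumTo n (λ r → altBinom n r * Δ f r)
alternating-sum-suc n f = begin
  sumTo (suc n) (λ r → altBinom (suc n) r * f r)
    ≡⟨ sumTo-suc n (λ r → altBinom (suc n) r * f r) ⟩
  1ℚ * f 0 + sumTo n (λ r → (altBinom n (suc r) - altBinom n r) * f (suc r))
    ≡⟨ cong (1ℚ * f 0 +_) (trans (sumTo-cong n (λ r _ → distrib (altBinom n (suc r)) (altBinom n r) (f (suc r))))
                                 (sumTo-- n (λ r → altBinom n (suc r) * f (suc r)) (λ r → altBinom n r * f (suc r)))) ⟩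
  1ℚ * f 0 + (A - B)
    ≡⟨ sym (+-assoc (1ℚ * f 0) A (- B)) ⟩
  (1ℚ * f 0 + A) - B
    ≡⟨ cong (_- B) (sym (sumTo-suc n (λ r → altBinom n r * f r))) ⟩
  S + altBinom n (suc n) * f (suc n) - B
    ≡⟨ cong (λ z → S + z * f (suc n) - B) (altBinom-vanish n (suc n) ℕ.≤-refl) ⟩
  S + 0ℚ * f (suc n) - B
    ≡⟨ solve 3 (λ S B x → S :+ con 0ℚ :* x :- B := :- (B :- S)) refl S B (f (suc n)) ⟩
  - (B - S)
    ≡⟨ cong -_ (sym (trans (sumTo-cong n (λ r _ → distrib′ (altBinom n r) (f (suc r)) (f r)))
                           (sumTo-- n (λ r → altBinom n r * f (suc r)) (λ r → altBinom n r * f r)))) ⟩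
  - sumTo n (λ r → altBinom n r * Δ f r)
    ∎
  where
  A : ℚ
  A = sumTo n (λ r → altBinom n (suc r) * f (suc r))
  B : ℚ
  B = sumTo n (λ r → altBinom n r * f (suc r))
  S : ℚ
  S = sumTo n (λ r → altBinom n r * f r)
  distrib : ∀ a b x → (a - b) * x ≡ a * x - b * x
  distrib = solve 3 (λ a b x → (a :- b) :* x := a :* x :- b :* x) refl
  distrib′ : ∀ a x y → a * (x - y) ≡ a * x - a * y
  distrib′ = solve 3 (λ a x y → a :* (x :- y) := a :* x :- a :* y) refl

alternating-sum-vanishes : ∀ n f → Degree< n f → sumTo n (λ r → altBinom n r * f r) ≡ 0ℚ
alternating-sum-vanishes zero    f df = trans (*-identityˡ (f 0)) (df 0)
alternating-sum-vanishes (suc n) f df =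
  trans (alternating-sum-suc n f) (cong -_ (alternating-sum-vanishes n (Δ f) df))

-- Both sides of the identity as one function of the upper parameter

module Symmetry (k m : ℕ) where

  K : ℕ
  K = suc k

  N : ℕ
  N = K *ℕ m +ℕ 1

  M : ℚ
  M = ℕ→ℚ m

  N≡1+Km : N ≡ suc (K *ℕ m)
  N≡1+Km = ℕ.+-comm (K *ℕ m) 1

  prefactor : ℚ → ℚ
  prefactor x = poch (x + 1ℚ) m

  lowerPoch : ℚ → ℕ → ℚ
  lowerPoch x r = poch (- (x + M)) r

  F : ℚ → ℚ
  F x = prefactor x ^ K * hypF N (replicate K (- x)) (replicate K (- (x + M)))

  numerator : ℚ → ℕ → ℚ
  numerator x r = poch (- ℕ→ℚ N) r * prodℚ (map (λ a → poch a r) (replicate K (- x)))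

  denominator : ℚ → ℕ → ℚ
  denominator x r = ℕ→ℚ (r !) * prodℚ (map (λ b → poch b r) (replicate K (- (x + M))))

  term : ℚ → ℕ → ℚ
  term x r = prefactor x ^ K * (numerator x r /₀ denominator x r)

  Φ : ℚ → ℕ → ℚ
  Φ x r = altBinom N r * poch ((x + 1ℚ) - ℕ→ℚ r) m ^ K

  F-cong : ∀ x {p q} → x + 1ℚ ≡ p → x + M ≡ q →
           F x ≡ poch p m ^ K * hypF N (replicate K (- x)) (replicate K (- q))
  F-cong x refl refl = refl

  F≡Σterm : ∀ x → F x ≡ sumTo N (term x)
  F≡Σterm x = sym (sumTo-*ˡ N (prefactor x ^ K) (hypTerm N (replicate K (- x)) (replicate K (- (x + M)))))

  denominator≡ : ∀ x r → denominator x r ≡ ℕ→ℚ (r !) * lowerPoch x r ^ K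
  denominator≡ x r = cong (ℕ→ℚ (r !) *_) (prodℚ-map-replicate (λ b → poch b r) (- (x + M)) K)

  prefactor*numerator : ∀ x r → prefactor x ^ K * numerator x r ≡ Φ x r * denominator x r
  prefactor*numerator x r = begin
    P ^ K * numerator x r
      ≡⟨ cong₂ (λ u v → P ^ K * (u * v)) (poch-neg-ℕ N r) (prodℚ-map-replicate (λ a → poch a r) (- x) K) ⟩
    P ^ K * (c * R! * A ^ K)
      ≡⟨ solve 4 (λ p c f a → p :* (c :* f :* a) := c :* f :* (p :* a)) refl (P ^ K) c R! (A ^ K) ⟩
    c * R! * (P ^ K * A ^ K)
      ≡⟨ cong (c * R! *_) (sym (^-distribʳ-* P A K)) ⟩
    c * R! * (P * A) ^ K
      ≡⟨ cong (λ z → c * R! * z ^ K) (poch-exchange x m r) ⟩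
    c * R! * (Q * lowerPoch x r) ^ K
      ≡⟨ cong (c * R! *_) (^-distribʳ-* Q (lowerPoch x r) K) ⟩
    c * R! * (Q ^ K * lowerPoch x r ^ K)
      ≡⟨ solve 4 (λ c f q d → c :* f :* (q :* d) := c :* q :* (f :* d)) refl c R! (Q ^ K) (lowerPoch x r ^ K) ⟩
    Φ x r * (R! * lowerPoch x r ^ K)
      ≡⟨ cong (Φ x r *_) (sym (denominator≡ x r)) ⟩
    Φ x r * denominator x r
      ∎
    where
    P : ℚ
    P = prefactor x
    A : ℚ
    A = poch (- x) r
    Q : ℚ
    Q = poch ((x + 1ℚ) - ℕ→ℚ r) m
    c : ℚ
    c = altBinom N r
    R! : ℚ
    R! = ℕ→ℚ (r !)

  term≡Φ : ∀ x r → ¬ lowerPoch x r ≡ 0ℚ → term x r ≡ Φ x r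
  term≡Φ x r D≢0 = *-/₀-unique {prefactor x ^ K} {Φ x r} denominator≢0 (prefactor*numerator x r)
    where
    denominator≢0 : ¬ denominator x r ≡ 0ℚ
    denominator≢0 e = *-≢0 (ℕ→ℚ-!≢0 r) (^-≢0 K D≢0) (trans (sym (denominator≡ x r)) e)

  term-ℕ-vanish : ∀ a r → a < r → term (ℕ→ℚ a) r ≡ 0ℚ
  term-ℕ-vanish a r a<r = begin
    P * (numerator x r /₀ denominator x r)    ≡⟨ cong (λ z → P * (z /₀ denominator x r)) numerator≡0 ⟩
    P * (0ℚ /₀ denominator x r)               ≡⟨ cong (P *_) (/₀-zeroˡ (denominator x r)) ⟩
    P * 0ℚ                                    ≡⟨ *-zeroʳ P ⟩
    0ℚ                                        ∎
    where
    x : ℚ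
    x = ℕ→ℚ a
    P : ℚ
    P = prefactor x ^ K
    numerator≡0 : numerator x r ≡ 0ℚ
    numerator≡0 = trans (cong (poch (- ℕ→ℚ N) r *_)
                              (trans (prodℚ-map-replicate (λ a → poch a r) (- x) K)
                                     (^-zero k (poch-neg-ℕ-vanish a r a<r))))
                        (*-zeroʳ (poch (- ℕ→ℚ N) r))

  ΣΦ≡0 : ∀ x → sumTo N (Φ x) ≡ 0ℚ
  ΣΦ≡0 x = alternating-sum-vanishes N f
    (subst (λ n → Degree< n f) (sym N≡1+Km) (Degree<-^ m (λ r → poch ((x + 1ℚ) - ℕ→ℚ r) m) K (Degree<-poch (x + 1ℚ) m)))
    where
    f : ℕ → ℚ
    f = λ r → poch ((x + 1ℚ) - ℕ→ℚ r) m ^ K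

  F≡0-if-prefactor≡0 : ∀ x → prefactor x ≡ 0ℚ → F x ≡ 0ℚ
  F≡0-if-prefactor≡0 x p≡0 = trans (cong (_* hypF N (replicate K (- x)) (replicate K (- (x + M)))) (^-zero k p≡0))
                       (*-zeroˡ (hypF N (replicate K (- x)) (replicate K (- (x + M)))))

  F≡0-if-lowerPoch≢0 : ∀ x → (∀ r → r ≤ N → ¬ lowerPoch x r ≡ 0ℚ) → F x ≡ 0ℚ
  F≡0-if-lowerPoch≢0 x D≢0 =
    trans (F≡Σterm x) (trans (sumTo-cong N (λ r r≤N → term≡Φ x r (D≢0 r r≤N))) (ΣΦ≡0 x))

  lowerPoch-ℕ-≢0 : ∀ a r → r ≤ a +ℕ m → ¬ lowerPoch (ℕ→ℚ a) r ≡ 0ℚ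
  lowerPoch-ℕ-≢0 a r r≤a+m e =
    poch-neg-ℕ-≢0 (a +ℕ m) r r≤a+m (trans (cong (λ z → poch (- z) r) (ℕ→ℚ-+ a m)) e)

  F-ℕ : ∀ a → a ≤ N → F (ℕ→ℚ a) ≡ sumTo a (Φ (ℕ→ℚ a))
  F-ℕ a a≤N = begin
    F (ℕ→ℚ a)                             ≡⟨ F≡Σterm (ℕ→ℚ a) ⟩
    sumTo N (term (ℕ→ℚ a))                ≡⟨ cong (λ n → sumTo n (term (ℕ→ℚ a))) (sym (ℕ.m+[n∸m]≡n a≤N)) ⟩
    sumTo (a +ℕ (N ∸ a)) (term (ℕ→ℚ a))   ≡⟨ sumTo-trailing-zeros a (N ∸ a) (term (ℕ→ℚ a))
                                                (λ i _ → term-ℕ-vanish a (suc a +ℕ i) (s≤s (ℕ.m≤m+n a i))) ⟩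
    sumTo a (term (ℕ→ℚ a))                ≡⟨ sumTo-cong a (λ r r≤a → term≡Φ (ℕ→ℚ a) r
                                                (lowerPoch-ℕ-≢0 a r (ℕ.≤-trans r≤a (ℕ.m≤m+n a m)))) ⟩
    sumTo a (Φ (ℕ→ℚ a))                   ∎

  Φ-vanish : ∀ t i → i < m → Φ (ℕ→ℚ t) (suc t +ℕ i) ≡ 0ℚ
  Φ-vanish t i i<m =
    trans (cong (altBinom N (suc t +ℕ i) *_) (^-zero k (trans (cong (λ z → poch z m) arg≡)
                                                               (poch-neg-ℕ-vanish i m i<m))))
          (*-zeroʳ (altBinom N (suc t +ℕ i)))
    where
    arg≡ : (ℕ→ℚ t + 1ℚ) - ℕ→ℚ (suc t +ℕ i) ≡ - ℕ→ℚ i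
    arg≡ = trans (cong (λ z → (ℕ→ℚ t + 1ℚ) - z) (trans (ℕ→ℚ-suc (t +ℕ i)) (cong (1ℚ +_) (ℕ→ℚ-+ t i))))
                 (solve 2 (λ t i → (t :+ con 1ℚ) :- (con 1ℚ :+ (t :+ i)) := :- i) refl (ℕ→ℚ t) (ℕ→ℚ i))

  [-1]^N*[[-1]^m]^K≡-1 : (- 1ℚ) ^ N * ((- 1ℚ) ^ m) ^ K ≡ - 1ℚ
  [-1]^N*[[-1]^m]^K≡-1 = begin
    (- 1ℚ) ^ N * ((- 1ℚ) ^ m) ^ K    ≡⟨ cong₂ _*_ (cong ((- 1ℚ) ^_) N≡1+Km) (^-*-assoc (- 1ℚ) m K) ⟩
    - 1ℚ * σ * σ                     ≡⟨ *-assoc (- 1ℚ) σ σ ⟩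
    - 1ℚ * (σ * σ)                   ≡⟨ cong (- 1ℚ *_) ([-1]^n*[-1]^n≡1 (K *ℕ m)) ⟩
    - 1ℚ * 1ℚ                        ≡⟨ *-identityʳ (- 1ℚ) ⟩
    - 1ℚ                             ∎
    where
    σ : ℚ
    σ = (- 1ℚ) ^ (K *ℕ m)

  reflected-argument : ∀ s t i j → s +ℕ t ≡ k *ℕ m → i +ℕ j ≡ N →
    (ℕ→ℚ s + 1ℚ) - ℕ→ℚ i ≡ - (((ℕ→ℚ t + 1ℚ) - ℕ→ℚ j) + M) + 1ℚ
  reflected-argument s t i j s+t≡km i+j≡N = begin
    (S + 1ℚ) - I                            ≡⟨ solve 3 (λ S I J → (S :+ con 1ℚ) :- I := (S :+ con 1ℚ) :- ((I :+ J) :- J))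
                                                       refl S I J ⟩
    (S + 1ℚ) - ((I + J) - J)                ≡⟨ cong (λ z → (S + 1ℚ) - (z - J)) I+J≡ ⟩
    (S + 1ℚ) - ((1ℚ + (M + (S + T))) - J)   ≡⟨ solve 4 (λ S T J M → (S :+ con 1ℚ) :- ((con 1ℚ :+ (M :+ (S :+ T))) :- J)
                                                                  := :- (((T :+ con 1ℚ) :- J) :+ M) :+ con 1ℚ)
                                                       refl S T J M ⟩
    - (((T + 1ℚ) - J) + M) + 1ℚ             ∎
    where
    S : ℚ
    S = ℕ→ℚ s
    T : ℚ
    T = ℕ→ℚ t
    I : ℚ
    I = ℕ→ℚ i
    J : ℚ
    J = ℕ→ℚ j
    I+J≡ : I + J ≡ 1ℚ + (M + (S + T))
    I+J≡ = begin
      I + J                       ≡⟨ sym (ℕ→ℚ-+ i j) ⟩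
      ℕ→ℚ (i +ℕ j)                ≡⟨ cong ℕ→ℚ (trans i+j≡N (trans N≡1+Km (cong (λ n → suc (m +ℕ n)) (sym s+t≡km)))) ⟩
      ℕ→ℚ (suc (m +ℕ (s +ℕ t)))   ≡⟨ ℕ→ℚ-suc (m +ℕ (s +ℕ t)) ⟩
      1ℚ + ℕ→ℚ (m +ℕ (s +ℕ t))    ≡⟨ cong (1ℚ +_) (trans (ℕ→ℚ-+ m (s +ℕ t)) (cong (M +_) (ℕ→ℚ-+ s t))) ⟩
      1ℚ + (M + (S + T))          ∎

  Φ-reflect : ∀ s t i j → s +ℕ t ≡ k *ℕ m → i +ℕ j ≡ N → Φ (ℕ→ℚ s) i ≡ - Φ (ℕ→ℚ t) j
  Φ-reflect s t i j s+t≡km i+j≡N = begin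
    altBinom N i * poch ((ℕ→ℚ s + 1ℚ) - ℕ→ℚ i) m ^ K
      ≡⟨ cong₂ (λ u v → u * poch v m ^ K) (altBinom-reflect i j N i+j≡N) (reflected-argument s t i j s+t≡km i+j≡N) ⟩
    (- 1ℚ) ^ N * c * poch (- (y + M) + 1ℚ) m ^ K
      ≡⟨ cong (λ z → (- 1ℚ) ^ N * c * z ^ K) (poch-reflect y m) ⟩
    (- 1ℚ) ^ N * c * ((- 1ℚ) ^ m * poch y m) ^ K
      ≡⟨ cong ((- 1ℚ) ^ N * c *_) (^-distribʳ-* ((- 1ℚ) ^ m) (poch y m) K) ⟩
    (- 1ℚ) ^ N * c * (((- 1ℚ) ^ m) ^ K * poch y m ^ K)
      ≡⟨ solve 4 (λ a c b p → a :* c :* (b :* p) := (a :* b) :* (c :* p))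
                 refl ((- 1ℚ) ^ N) c (((- 1ℚ) ^ m) ^ K) (poch y m ^ K) ⟩
    ((- 1ℚ) ^ N * ((- 1ℚ) ^ m) ^ K) * Φ (ℕ→ℚ t) j
      ≡⟨ cong (_* Φ (ℕ→ℚ t) j) [-1]^N*[[-1]^m]^K≡-1 ⟩
    - 1ℚ * Φ (ℕ→ℚ t) j
      ≡⟨ solve 1 (λ z → :- con 1ℚ :* z := :- z) refl (Φ (ℕ→ℚ t) j) ⟩
    - Φ (ℕ→ℚ t) j
      ∎
    where
    c : ℚ
    c = altBinom N j
    y : ℚ
    y = (ℕ→ℚ t + 1ℚ) - ℕ→ℚ j

  F-symmetric-≤ : ∀ s t → s +ℕ t ≡ k *ℕ m → F (ℕ→ℚ s) ≡ F (ℕ→ℚ t)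
  F-symmetric-≤ s t s+t≡km = begin
    F (ℕ→ℚ s)                  ≡⟨ F-ℕ s (≤N (ℕ.m≤m+n s t)) ⟩
    G s                        ≡⟨ solve 2 (λ x y → x := (x :+ :- y) :+ y) refl (G s) (G t) ⟩
    (G s + - G t) + G t        ≡⟨ cong (λ z → (G s + z) + G t) (sym tail≡-Gt) ⟩
    (G s + tail) + G t         ≡⟨ cong (_+ G t) (trans (sym split) (ΣΦ≡0 (ℕ→ℚ s))) ⟩
    0ℚ + G t                   ≡⟨ +-identityˡ (G t) ⟩
    G t                        ≡⟨ sym (F-ℕ t (≤N (ℕ.m≤n+m t s))) ⟩
    F (ℕ→ℚ t)                  ∎
    where
    G : ℕ → ℚ
    G a = sumTo a (Φ (ℕ→ℚ a))
    tail : ℚ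
    tail = sumTo (t +ℕ m) (λ i → Φ (ℕ→ℚ s) (i +ℕ suc s))
    ≤N : ∀ {a} → a ≤ s +ℕ t → a ≤ N
    ≤N {a} a≤s+t = subst (a ≤_) (sym N≡1+Km)
      (ℕ.≤-trans (subst (a ≤_) s+t≡km a≤s+t) (ℕ.m≤n+m (k *ℕ m) (suc m)))
    N≡t+m+1+s : N ≡ (t +ℕ m) +ℕ suc s
    N≡t+m+1+s = trans N≡1+Km (trans (cong (λ n → suc (m +ℕ n)) (sym s+t≡km)) (rearrange s t m))
      where
      rearrange : ∀ s t m → suc (m +ℕ (s +ℕ t)) ≡ (t +ℕ m) +ℕ suc s
      rearrange = solve-∀
    split : sumTo N (Φ (ℕ→ℚ s)) ≡ G s + tail
    split = trans (cong (λ n → sumTo n (Φ (ℕ→ℚ s))) N≡t+m+1+s) (sumTo-split s (t +ℕ m) (Φ (ℕ→ℚ s)))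
    tail≡-Gt : tail ≡ - G t
    tail≡-Gt = begin
      tail                                ≡⟨ sumTo-reflect (t +ℕ m) _ _ (λ i j i+j≡t+m →
                                               Φ-reflect s t (i +ℕ suc s) j s+t≡km
                                                 (trans (swap i j (suc s)) (trans (cong (_+ℕ suc s) i+j≡t+m) (sym N≡t+m+1+s)))) ⟩
      sumTo (t +ℕ m) (λ j → - Φ (ℕ→ℚ t) j) ≡⟨ sumTo-neg (t +ℕ m) (Φ (ℕ→ℚ t)) ⟩
      - sumTo (t +ℕ m) (Φ (ℕ→ℚ t))        ≡⟨ cong -_ (sumTo-trailing-zeros t m (Φ (ℕ→ℚ t)) (Φ-vanish t)) ⟩
      - G t                               ∎
      where
      swap : ∀ i j a → (i +ℕ a) +ℕ j ≡ (i +ℕ j) +ℕ a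
      swap = solve-∀

  F-negative≡0 : ∀ u → F (- ℕ→ℚ (suc u)) ≡ 0ℚ
  F-negative≡0 u with suc u ≤? m
  ... | yes u<m = F≡0-if-prefactor≡0 (- ℕ→ℚ (suc u)) (trans (cong (λ z → poch z m) arg≡) (poch-neg-ℕ-vanish u m u<m))
    where
    arg≡ : - ℕ→ℚ (suc u) + 1ℚ ≡ - ℕ→ℚ u
    arg≡ = trans (cong (λ z → - z + 1ℚ) (ℕ→ℚ-suc u))
                 (solve 1 (λ u → :- (con 1ℚ :+ u) :+ con 1ℚ := :- u) refl (ℕ→ℚ u))
  ... | no  u≮m = F≡0-if-lowerPoch≢0 (- ℕ→ℚ (suc u))
          (λ r _ e → poch-ℕ-suc-≢0 (u ∸ m) r (trans (cong (λ z → poch z r) (sym arg≡)) e))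
    where
    m≤u : m ≤ u
    m≤u = ℕ.≤-pred (ℕ.≰⇒> u≮m)
    arg≡ : - (- ℕ→ℚ (suc u) + M) ≡ ℕ→ℚ (suc (u ∸ m))
    arg≡ = begin
      - (- ℕ→ℚ (suc u) + M)          ≡⟨ cong (λ z → - (- z + M)) (ℕ→ℚ-suc u) ⟩
      - (- (1ℚ + ℕ→ℚ u) + M)         ≡⟨ solve 2 (λ u M → :- (:- (con 1ℚ :+ u) :+ M) := con 1ℚ :+ (u :- M)) refl (ℕ→ℚ u) M ⟩
      1ℚ + (ℕ→ℚ u - M)               ≡⟨ cong (1ℚ +_) (sym (ℕ→ℚ-∸ u m m≤u)) ⟩
      1ℚ + ℕ→ℚ (u ∸ m)               ≡⟨ sym (ℕ→ℚ-suc (u ∸ m)) ⟩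
      ℕ→ℚ (suc (u ∸ m))              ∎

  F-symmetric-> : ∀ s → k *ℕ m < s → F (ℕ→ℚ s) ≡ F (ℕ→ℚ (k *ℕ m) - ℕ→ℚ s)
  F-symmetric-> s km<s = trans
    (F≡0-if-lowerPoch≢0 (ℕ→ℚ s) (λ r r≤N → lowerPoch-ℕ-≢0 s r (ℕ.≤-trans r≤N N≤s+m)))
    (sym (trans (cong F x≡) (F-negative≡0 u)))
    where
    u : ℕ
    u = s ∸ suc (k *ℕ m)
    N≤s+m : N ≤ s +ℕ m
    N≤s+m = subst (_≤ s +ℕ m) (sym (trans N≡1+Km (cong suc (ℕ.+-comm m (k *ℕ m))))) (ℕ.+-monoˡ-≤ m km<s)
    x≡ : ℕ→ℚ (k *ℕ m) - ℕ→ℚ s ≡ - ℕ→ℚ (suc u)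
    x≡ = begin
      KM - ℕ→ℚ s                        ≡⟨ cong (λ z → KM - ℕ→ℚ z) (sym (ℕ.m∸n+n≡m km<s)) ⟩
      KM - ℕ→ℚ (u +ℕ suc (k *ℕ m))      ≡⟨ cong (λ z → KM - z) (trans (ℕ→ℚ-+ u (suc (k *ℕ m))) (cong (ℕ→ℚ u +_) (ℕ→ℚ-suc (k *ℕ m)))) ⟩
      KM - (ℕ→ℚ u + (1ℚ + KM))          ≡⟨ solve 2 (λ u x → x :- (u :+ (con 1ℚ :+ x)) := :- (con 1ℚ :+ u)) refl (ℕ→ℚ u) KM ⟩
      - (1ℚ + ℕ→ℚ u)                    ≡⟨ cong -_ (sym (ℕ→ℚ-suc u)) ⟩
      - ℕ→ℚ (suc u)                     ∎
      where
      KM : ℚ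
      KM = ℕ→ℚ (k *ℕ m)

  F-symmetric : ∀ s → F (ℕ→ℚ s) ≡ F (ℕ→ℚ (k *ℕ m) - ℕ→ℚ s)
  F-symmetric s with s ≤? k *ℕ m
  ... | yes s≤km = trans (F-symmetric-≤ s (k *ℕ m ∸ s) (ℕ.m+[n∸m]≡n s≤km)) (cong F (ℕ→ℚ-∸ (k *ℕ m) s s≤km))
  ... | no  s≰km = F-symmetric-> s (ℕ.≰⇒> s≰km)

corollary3p5 : (k m s : ℕ) → 1 ≤ k → 1 ≤ m →
    (poch (ℕ→ℚ (s +ℕ 1)) m ^ (k +ℕ 1))
      * hypF ((k +ℕ 1) *ℕ m +ℕ 1)
             (replicate (k +ℕ 1) (- ℕ→ℚ s))
             (replicate (k +ℕ 1) (- ℕ→ℚ (m +ℕ s)))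
    ≡ (poch (ℕ→ℚ (k *ℕ m +ℕ 1) - ℕ→ℚ s) m ^ (k +ℕ 1))
      * hypF ((k +ℕ 1) *ℕ m +ℕ 1)
             (replicate (k +ℕ 1) (- (ℕ→ℚ (k *ℕ m) - ℕ→ℚ s)))
             (replicate (k +ℕ 1) (- (ℕ→ℚ ((k +ℕ 1) *ℕ m) - ℕ→ℚ s)))
corollary3p5 k m s _ _ rewrite ℕ.+-comm k 1 =
  trans (sym (F-cong (ℕ→ℚ s) (sym (ℕ→ℚ-+ s 1)) (trans (+-comm (ℕ→ℚ s) M) (sym (ℕ→ℚ-+ m s)))))
        (trans (F-symmetric s) (F-cong x x+1≡ x+M≡))
  where
  open Symmetry k m
  x : ℚ
  x = ℕ→ℚ (k *ℕ m) - ℕ→ℚ s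
  x+1≡ : x + 1ℚ ≡ ℕ→ℚ (k *ℕ m +ℕ 1) - ℕ→ℚ s
  x+1≡ = trans (solve 2 (λ a b → (a :- b) :+ con 1ℚ := (a :+ con 1ℚ) :- b) refl (ℕ→ℚ (k *ℕ m)) (ℕ→ℚ s))
               (cong (_- ℕ→ℚ s) (sym (ℕ→ℚ-+ (k *ℕ m) 1)))
  x+M≡ : x + M ≡ ℕ→ℚ (suc k *ℕ m) - ℕ→ℚ s
  x+M≡ = trans (solve 3 (λ a b M → (a :- b) :+ M := (M :+ a) :- b) refl (ℕ→ℚ (k *ℕ m)) (ℕ→ℚ s) M)
               (cong (_- ℕ→ℚ s) (sym (ℕ→ℚ-+ m (k *ℕ m))))
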